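{- Given a framed graph $G$ on the vertex set $[n]$, the routes of $G$ which give the vertices of the simplex $\mathcal{F}_{(\cdots (G_{T_2}^{(2)})^{(3)}_{T_3}\cdots)_{T_{n-1}}^{(n-1)}}$ form a maximal clique with respect to the coherence relation in $G$. The framing of $(\cdots(G_{T_2}^{(2)})^{(3)}_{T_3}\cdots)_{T_{i}}^{(i)}$ is the inheritance framing obtained from the framing of $(\cdots(G_{T_2}^{(2)})^{(3)}_{T_3}\cdots)_{T_{i-1}}^{(i-1)}$.
   Context: Let $G$ be a connected loopless (multi)graph on $[n]$ with edges directed from smaller to larger vertex, each vertex in $[2,n-1]$ having both incoming and outgoing edges, and equipped with a framing: at each inner vertex $v$, linear orders on its incoming and on its outgoing edges. $\mathcal{F}_G$ is the polytope of nonnegative edge flows with net flow $1$ out of vertex $1$, $1$ into vertex $n$, and conservation at inner vertices. Routes are maximal directed paths from $1$ to $n$ (they give the vertices of $\mathcal{F}_G$). Coherence: at an inner vertex $v$, maximal paths ending at $v$ are ordered by: $P\prec Q$ iff at the largest vertex $w$ after which $P,Q$ coincide and before which they differ, the edge of $P$ entering $w$ precedes that of $Q$ in the framing at $w$; maximal paths starting at $v$ are ordered analogously via outgoing edges. Routes $P,Q$ are coherent at a common inner vertex $v$ if their segments ending at $v$ and their segments starting at $v$ are ordered the same way; coherent if coherent at every common inner vertex. A clique is a set of mutually coherent routes. Reductions: a bipartite noncrossing tree on ordered left vertices $x_1,\dots,x_\ell$ and ordered right vertices $x_{\ell+1},\dots,x_{\ell+r}$ is a tree with no two edges $(x_p,x_{\ell+q}),(x_t,x_{\ell+u})$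 with $p<t$, $q>u$. For vertex $i$ with incoming edges $\mathcal{I}_i$ and outgoing edges $\mathcal{O}_i$ ordered by the framing, and a bipartite noncrossing tree $T$ on left set $\mathcal{I}_i$ and right set $\mathcal{O}_i$, $G^{(i)}_T$ is obtained by deleting $i$ and its incident edges and adding, for each tree edge $((r,i),(i,s))$, the edge $(r,s)$ (the sum of the two edges; iterated sums of consecutive edges of $G$ are remembered). The inheritance framing of $G^{(i)}_T$: at vertices $j>i$ outgoing edges keep their order; each incoming edge of $j$ is a sum involving exactly one original incoming edge $m_l$ of $j$; with $S(m_l)$ the set of such edges, edges in $S(m_l)$ are ordered top to bottom as their tree edges appear in $T$ (left and right vertices drawn vertically in order), and every edge of $S(m_p)$ precedes every edge of $S(m_q)$ when $m_p$ precedes $m_q$; edges at vertices smaller than $i$ are ordered arbitrarily. Applying reductions successively at vertices $2,\dots,n-1$ with trees $T_2,\dots,T_{n-1}$ gives a graph on vertices $1,n$ with $\#E(G)-n+2$ edges, each a sum of edges of $G$ forming a route of $G$; its flow polytope is a simplex whose vertices correspond to these routes, and all such simplices triangulate $\mathcal{F}_G$. -}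

module Defs where

open import Data.Bool using (Bool; true; false; if_then_else_; _∨_)
open import Data.Nat using (ℕ; zero; suc; _≤_; _<_; _+_; _∸_)
open import Data.Fin using (Fin; toℕ)
import Data.Fin.Properties as FP
open import Data.List using (List; []; _∷_; _++_; [_]; _∷ʳ_; filterᵇ; concatMap; map; length; lookup; allFin)
import Data.List.Properties as LP
open import Data.List.Membership.Propositional using (_∈_)
open import Data.List.Relation.Unary.All using (All)
open import Data.List.Relation.Unary.Any using (any?)
open import Data.List.Relation.Unary.Unique.Propositional using (Unique)
open import Data.Product using (Σ; ∃; ∃-syntax; _×_; _,_)
import Data.Product.Properties as PP
open import Data.Sum using (_⊎_; inj₁; inj₂)
open import Relation.Nullary using (¬_; does)
open import Relation.Binary.PropositionalEquality using (_≡_; _≢_)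
open import Relation.Binary.Construct.Closure.ReflexiveTransitive using (Star)
open import Function.Bundles using (_⇔_)
import Data.Nat as N

Precedes : {A : Set} → List A → A → A → Set
Precedes L x y = ∃[ L₁ ] ∃[ L₂ ] ∃[ L₃ ] (L ≡ L₁ ++ (x ∷ (L₂ ++ (y ∷ L₃))))

-- Bipartite noncrossing trees on left vertices Fin ℓ, right vertices Fin r.
-- A tree is given by its (duplicate-free) list of edges (p , q).

data BAdj {ℓ r : ℕ} (T : List (Fin ℓ × Fin r)) : Fin ℓ ⊎ Fin r → Fin ℓ ⊎ Fin r → Set where
  lr : ∀ {p q} → (p , q) ∈ T → BAdj T (inj₁ p) (inj₂ q)
  rl : ∀ {p q} → (p , q) ∈ T → BAdj T (inj₂ q) (inj₁ p)

IsBipartiteTree : {ℓ r : ℕ} → List (Fin ℓ × Fin r) → Set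
IsBipartiteTree {ℓ} {r} T =
  Unique T × length T ≡ (ℓ + r) ∸ 1 × (∀ x y → Star (BAdj T) x y)

NonCrossing : {ℓ r : ℕ} → List (Fin ℓ × Fin r) → Set
NonCrossing T = ∀ p q t u → (p , q) ∈ T → (t , u) ∈ T → toℕ p N.< toℕ t → toℕ u N.< toℕ q → Data.Empty.⊥
  where import Data.Empty

IsNCTree : {ℓ r : ℕ} → List (Fin ℓ × Fin r) → Set
IsNCTree T = IsBipartiteTree T × NonCrossing T

inTree : {ℓ r : ℕ} → List (Fin ℓ × Fin r) → Fin ℓ → Fin r → Bool
inTree T p q = does (any? (λ x → PP.≡-dec FP._≟_ FP._≟_ x (p , q)) T)

-- Framed graphs on [n] = {1,…,n}; edges are Fin m (multigraph),
-- edge e goes from src e to tgt e.  Framing: at vertex v, inFr v is the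
-- linear order of incoming edges, outFr v that of outgoing edges
-- (only meaningful / constrained at inner vertices).

record FramedGraph (n : ℕ) : Set where
  field
    m     : ℕ
    src   : Fin m → ℕ
    tgt   : Fin m → ℕ
    inFr  : ℕ → List (Fin m)
    outFr : ℕ → List (Fin m)

module _ {n : ℕ} (G : FramedGraph n) where
  open FramedGraph G

  Inner : ℕ → Set
  Inner v = 2 ≤ v × v < n

  data UAdj : ℕ → ℕ → Set where
    fwd : ∀ e → UAdj (src e) (tgt e)
    bwd : ∀ e → UAdj (tgt e) (src e)

  IsFramedGraph : Set
  IsFramedGraph =
    (∀ e → 1 ≤ src e × src e < tgt e × tgt e ≤ n)
    × (∀ u v → 1 ≤ u → u ≤ n → 1 ≤ v → v ≤ n → Star UAdj u v)
    × (∀ v → Inner v → (∃[ e ] tgt e ≡ v) × (∃[ e ] src e ≡ v))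
    × (∀ v → Inner v → Unique (inFr v) × (∀ e → (e ∈ inFr v) ⇔ (tgt e ≡ v)))
    × (∀ v → Inner v → Unique (outFr v) × (∀ e → (e ∈ outFr v) ⇔ (src e ≡ v)))

  data Path : ℕ → List (Fin m) → ℕ → Set where
    edge : ∀ e → Path (src e) [ e ] (tgt e)
    cons : ∀ e {P v} → Path (tgt e) P v → Path (src e) (e ∷ P) v

  Route : List (Fin m) → Set
  Route P = Path 1 P n

  -- order on maximal paths ending at a vertex: compare at the last divergence
  InLess : List (Fin m) → List (Fin m) → Set
  InLess P Q = ∃[ A ] ∃[ B ] ∃[ e ] ∃[ f ] ∃[ C ]
    (P ≡ A ++ (e ∷ C)) × (Q ≡ B ++ (f ∷ C)) × (e ≢ f) × Precedes (inFr (tgt e)) e f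

  -- order on maximal paths starting at a vertex: compare at the first divergence
  OutLess : List (Fin m) → List (Fin m) → Set
  OutLess P Q = ∃[ C ] ∃[ e ] ∃[ f ] ∃[ A ] ∃[ B ]
    (P ≡ C ++ (e ∷ A)) × (Q ≡ C ++ (f ∷ B)) × (e ≢ f) × Precedes (outFr (src e)) e f

  EndsAt : List (Fin m) → ℕ → Set
  EndsAt P v = ∃[ P' ] ∃[ e ] (P ≡ P' ∷ʳ e) × tgt e ≡ v

  CoherentAt : ℕ → List (Fin m) → List (Fin m) → Set
  CoherentAt v P Q = ∀ Pa Pb Qa Qb → P ≡ Pa ++ Pb → Q ≡ Qa ++ Qb → EndsAt Pa v → EndsAt Qa v →
    ¬ (InLess Pa Qa × OutLess Qb Pb) × ¬ (InLess Qa Pa × OutLess Pb Qb)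

  Coherent : List (Fin m) → List (Fin m) → Set
  Coherent P Q = ∀ v → Inner v → CoherentAt v P Q

  Clique : List (List (Fin m)) → Set
  Clique S = All Route S × (∀ P Q → P ∈ S → Q ∈ S → Coherent P Q)

  MaximalClique : List (List (Fin m)) → Set
  MaximalClique S = Clique S × (∀ R → Route R → (∀ P → P ∈ S → Coherent R P) → R ∈ S)

  -- Reductions.  An edge of a reduced graph is remembered as the list of
  -- edges of G of which it is the (iterated) sum.

  pathSrc : List (Fin m) → ℕ
  pathSrc []      = 0
  pathSrc (e ∷ _) = src e

  pathTgt : List (Fin m) → ℕ
  pathTgt []          = 0
  pathTgt (e ∷ [])    = tgt e
  pathTgt (_ ∷ e ∷ P) = pathTgt (e ∷ P)

  record State : Set where
    field
      edges : List (List (Fin m))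
      inO   : ℕ → List (List (Fin m))
      outO  : ℕ → List (List (Fin m))

  initState : State
  initState = record
    { edges = map [_] (allFin m)
    ; inO   = λ v → map [_] (inFr v)
    ; outO  = λ v → map [_] (outFr v) }

  TreeAt : State → ℕ → Set
  TreeAt s i = List (Fin (length (State.inO s i)) × Fin (length (State.outO s i)))

  _≟ᴸ_ : (x y : List (Fin m)) → Relation.Nullary.Dec (x ≡ y)
  _≟ᴸ_ = LP.≡-dec FP._≟_
    where import Relation.Nullary

  -- G^{(i)}_T with the inheritance framing
  reduce : (s : State) (i : ℕ) → TreeAt s i → State
  reduce s i T = record { edges = newEdges ; inO = newIn ; outO = newOut }
    where
      I = State.inO s i
      O = State.outO s i
      ℓ = length I
      r = length O

      incident : List (Fin m) → Bool
      incident g = does (pathSrc g N.≟ i) ∨ does (pathTgt g N.≟ i)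

      newEdges : List (List (Fin m))
      newEdges = filterᵇ (λ g → if incident g then false else true) (State.edges s)
                 ++ map (λ { (p , q) → lookup I p ++ lookup O q }) T

      -- incoming edge g of j (> i): replaced by the sums for the tree edges
      -- at its right vertex, top to bottom (by left vertex)
      expandIn : List (Fin m) → List (List (Fin m))
      expandIn g = if does (pathSrc g N.≟ i)
        then concatMap (λ q → if does (lookup O q ≟ᴸ g)
                 then concatMap (λ p → if inTree T p q then [ lookup I p ++ lookup O q ] else []) (allFin ℓ)
                 else []) (allFin r)
        else [ g ]

      -- outgoing edges (only relevant at vertices < i, where order is arbitrary)
      expandOut : List (Fin m) → List (List (Fin m))
      expandOut g = if does (pathTgt g N.≟ i)
        then concatMap (λ p → if does (lookup I p ≟ᴸ g)
                 then concatMap (λ q → if inTree T p q then [ lookup I p ++ lookup O q ] else []) (allFin r)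
                 else []) (allFin ℓ)
        else [ g ]

      newIn : ℕ → List (List (Fin m))
      newIn j = if does (j N.≟ i) then [] else concatMap expandIn (State.inO s j)

      newOut : ℕ → List (List (Fin m))
      newOut j = if does (j N.≟ i) then [] else concatMap expandOut (State.outO s j)

  data Runs : ℕ → State → State → Set where
    finish : ∀ {i s} → n ≤ i → Runs i s s
    step   : ∀ {i s s'} → i < n → (T : TreeAt s i) → IsNCTree T →
             Runs (suc i) (reduce s i T) s' → Runs i s s'

module Submission where

-- An invariant `Inv i s` holds after reducing at 2, …, i-1: each edge is an
-- original edge leaving a vertex ≥ i or a path from 1 to a vertex ≥ i with
-- inner vertices < i; in-framings at j ≥ i are sorted by the order on paths
-- ending at j, out-framings there are the original ones; and no two edges
-- witness an incoherence ("partial coherence").  A reduction at i creates the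
-- edges I_p ++ O_q for tree edges (p , q); two new edges stay partially
-- coherent by noncrossingness, a new and a surviving edge because the
-- survivor avoids i.  At the end every edge is a route: a clique.  For
-- maximality, a route R coherent with all final routes continues its prefix
-- I_p by some O_q; were (p , q) not a tree edge, a crossing tree edge would
-- give a final route incoherent with R at i, so R's prefixes survive.

open import Defs
open import Data.Nat using (ℕ; suc; _≤_; _<_; s≤s)
import Data.Nat as N
import Data.Nat.Properties as NP
open import Data.Bool using (Bool; true; false; if_then_else_; _∨_; T?) renaming (T to IsTrue)
open import Data.Fin using (Fin; toℕ)
import Data.Fin as F
import Data.Fin.Properties as FP
open import Data.List using (List; []; _∷_; _++_; [_]; _∷ʳ_; filterᵇ; concatMap; map; length; lookup; allFin; reverse)
open import Data.List.Properties using (++-assoc; ++-identityʳ; ++-cancelˡ; ++-conicalˡ; ++-conicalʳ; ∷-injective; ∷-injectiveˡ; ∷-injectiveʳ; ∷ʳ-injectiveʳ; reverse-++; unfold-reverse; map-tabulate)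
open import Data.List.Membership.Propositional using (_∈_; find)
open import Data.List.Membership.Propositional.Properties using (∈-++⁺ˡ; ∈-++⁺ʳ; ∈-++⁻; ∈-map⁺; ∈-map⁻; ∈-lookup; ∈-allFin; ∈-∃++; ∈-concatMap⁺; ∈-concatMap⁻; ∈-filter⁺; ∈-filter⁻)
open import Data.List.Relation.Unary.All using (All; []; _∷_)
import Data.List.Relation.Unary.All as All
import Data.List.Relation.Unary.All.Properties as AllP
open import Data.List.Relation.Unary.Any using (Any; here; there; any?)
import Data.List.Relation.Unary.Any as Any
import Data.List.Relation.Unary.Any.Properties as AnyP
open import Data.List.Relation.Unary.AllPairs using (AllPairs; []; _∷_)
import Data.List.Relation.Unary.AllPairs as AP
import Data.List.Relation.Unary.AllPairs.Properties as APP
open import Data.List.Relation.Unary.Unique.Propositional using (Unique)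
open import Data.Product using (Σ; ∃; _×_; _,_; proj₁; proj₂)
import Data.Product.Properties as PP
open import Data.Sum using (_⊎_; inj₁; inj₂)
open import Data.Empty using (⊥; ⊥-elim)
open import Data.Unit using (tt)
open import Relation.Nullary using (¬_; Dec; yes; no; does)
open import Relation.Nullary.Decidable using (toWitness; fromWitness; isYes≗does)
open import Relation.Binary.Definitions using (tri<; tri≈; tri>)
open import Relation.Binary.PropositionalEquality using (_≡_; _≢_; refl; sym; trans; cong; subst; subst₂; cong₂; module ≡-Reasoning)
open import Relation.Binary.Construct.Closure.ReflexiveTransitive using (Star; ε; _◅_)
open import Function.Bundles using (_⇔_; Equivalence)

module _ {A : Set} where

  split-at-∷ : (C Q : List A) (e : A) (A' k : List A) → C ++ e ∷ A' ≡ Q ++ k →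
               (∃ λ A'' → Q ≡ C ++ e ∷ A'') ⊎ (∃ λ D → C ≡ Q ++ D)
  split-at-∷ [] [] e A' k eq = inj₂ ([] , refl)
  split-at-∷ [] (q ∷ Q) e A' k eq = inj₁ (Q , cong (_∷ Q) (sym (∷-injectiveˡ eq)))
  split-at-∷ (c ∷ C) [] e A' k eq = inj₂ (c ∷ C , refl)
  split-at-∷ (c ∷ C) (q ∷ Q) e A' k eq with ∷-injective eq
  ... | refl , eq' with split-at-∷ C Q e A' k eq'
  ...   | inj₁ (A'' , p) = inj₁ (A'' , cong (c ∷_) p)
  ...   | inj₂ (D , p) = inj₂ (D , cong (c ∷_) p)

  first-divergence : (C C' : List A) {e e' f f' : A} {A₁ A₁' B₁ B₁' : List A} →
    C ++ e ∷ A₁ ≡ C' ++ e' ∷ A₁' → C ++ f ∷ B₁ ≡ C' ++ f' ∷ B₁' → e ≢ f → e' ≢ f' →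
    C ≡ C' × e ≡ e' × f ≡ f'
  first-divergence [] [] eq1 eq2 ne ne' = refl , ∷-injectiveˡ eq1 , ∷-injectiveˡ eq2
  first-divergence [] (c ∷ C') eq1 eq2 ne ne' = ⊥-elim (ne (trans (∷-injectiveˡ eq1) (sym (∷-injectiveˡ eq2))))
  first-divergence (c ∷ C) [] eq1 eq2 ne ne' = ⊥-elim (ne' (trans (sym (∷-injectiveˡ eq1)) (∷-injectiveˡ eq2)))
  first-divergence (c ∷ C) (c' ∷ C') eq1 eq2 ne ne' with ∷-injective eq1
  ... | refl , eq1' with first-divergence C C' eq1' (∷-injectiveʳ eq2) ne ne'
  ...   | refl , p , q = refl , p , q

  -- Reversal turns a last divergence into a first divergence.
  reverse-middle : (A' : List A) (e : A) (C : List A) → reverse (A' ++ e ∷ C) ≡ reverse C ++ e ∷ reverse A'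
  reverse-middle A' e C = begin
      reverse (A' ++ e ∷ C)              ≡⟨ reverse-++ A' (e ∷ C) ⟩
      reverse (e ∷ C) ++ reverse A'      ≡⟨ cong (_++ reverse A') (unfold-reverse e C) ⟩
      (reverse C ++ [ e ]) ++ reverse A' ≡⟨ ++-assoc (reverse C) [ e ] (reverse A') ⟩
      reverse C ++ e ∷ reverse A'        ∎
    where open ≡-Reasoning

  singleton-split : {e : A} (a b : List A) → [ e ] ≡ a ++ b → a ≡ [] ⊎ b ≡ []
  singleton-split [] b eq = inj₁ refl
  singleton-split (x ∷ []) [] eq = inj₂ refl
  singleton-split (x ∷ []) (y ∷ b) ()
  singleton-split (x ∷ x' ∷ a) b ()

  singleton-as-∷ : {e' a : A} (D A' : List A) → [ e' ] ≡ D ++ a ∷ A' → D ≡ [] × a ≡ e'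
  singleton-as-∷ [] A' eq = refl , sym (∷-injectiveˡ eq)
  singleton-as-∷ (d ∷ D) A' eq with ++-conicalʳ D (_ ∷ A') (sym (∷-injectiveʳ eq))
  ... | ()

  ++-∷-nonempty : (D : List A) {a : A} {A' : List A} → D ++ a ∷ A' ≢ []
  ++-∷-nonempty D {a} {A'} eq with ++-conicalʳ D (a ∷ A') eq
  ... | ()

  snoc-split : (ga gb x : List A) (e : A) → ga ++ gb ≡ x ++ [ e ] → gb ≢ [] →
               ∃ λ gx → x ≡ ga ++ gx × gb ≡ gx ++ [ e ]
  snoc-split [] gb x e eq ne = x , refl , eq
  snoc-split (a ∷ ga) gb [] e eq ne = ⊥-elim (ne (++-conicalʳ ga gb (∷-injectiveʳ eq)))
  snoc-split (a ∷ ga) gb (y ∷ x) e eq ne with ∷-injective eq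
  ... | refl , eq' with snoc-split ga gb x e eq' ne
  ...   | gx , p , q = gx , cong (a ∷_) p , q

  init-last : (b : List A) → b ≢ [] → ∃ λ b' → ∃ λ f → b ≡ b' ∷ʳ f
  init-last [] ne = ⊥-elim (ne refl)
  init-last (x ∷ []) ne = [] , x , refl
  init-last (x ∷ y ∷ b) ne with init-last (y ∷ b) (λ ())
  ... | b' , f , eq = x ∷ b' , f , cong (x ∷_) eq

  lookup-AllPairs : ∀ {R : A → A → Set} {L : List A} → AllPairs R L → ∀ {p p' : Fin (length L)} →
                    toℕ p < toℕ p' → R (lookup L p) (lookup L p')
  lookup-AllPairs {L = x ∷ L} (px ∷ pL) {Fin.zero} {Fin.suc p'} lt = All.lookup px (∈-lookup p')
  lookup-AllPairs {L = x ∷ L} (px ∷ pL) {Fin.suc p} {Fin.suc p'} (s≤s lt) = lookup-AllPairs pL lt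

  index-of : ∀ {x : A} {L : List A} → x ∈ L → Σ (Fin (length L)) λ p → lookup L p ≡ x
  index-of m = Any.index m , sym (AnyP.lookup-index m)

  AllPairs-concatMap-allFin : ∀ {R : A → A → Set} {k} (f : Fin k → List A) → (∀ q → AllPairs R (f q)) →
    (∀ {q q'} → q F.< q' → All (λ a → All (R a) (f q')) (f q)) → AllPairs R (concatMap f (allFin k))
  AllPairs-concatMap-allFin {R} {k} f within across rewrite map-tabulate (λ x → x) f =
    APP.concat⁺ (AllP.tabulate⁺ within) (APP.tabulate⁺-< across)

  ∈-concatMap-allFin⁻ : ∀ {k} (f : Fin k → List A) {a} → a ∈ concatMap f (allFin k) → ∃ λ q → a ∈ f q
  ∈-concatMap-allFin⁻ {k} f m = Any.satisfied (∈-concatMap⁻ f {xs = allFin k} m)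

  ∈-concatMap-allFin⁺ : ∀ {k} (f : Fin k → List A) {a} q → a ∈ f q → a ∈ concatMap f (allFin k)
  ∈-concatMap-allFin⁺ f q m = ∈-concatMap⁺ f (Any.map (λ { refl → m }) (∈-allFin q))

  ∈-concatMap-find : (f : A → List A) {L : List A} {a : A} → a ∈ concatMap f L → ∃ λ g → g ∈ L × a ∈ f g
  ∈-concatMap-find f {L} m = find (∈-concatMap⁻ f {xs = L} m)

  ∈-concatMap-at : (f : A → List A) {L : List A} {a g : A} → g ∈ L → a ∈ f g → a ∈ concatMap f L
  ∈-concatMap-at f {L} gm am = ∈-concatMap⁺ f {xs = L} (Any.map (λ { refl → am }) gm)

  concatMap-singleton : (f : A → List A) {L : List A} → All (λ g → f g ≡ [ g ]) L → concatMap f L ≡ L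
  concatMap-singleton f [] = refl
  concatMap-singleton f {x ∷ L} (px ∷ pL) rewrite px = cong (x ∷_) (concatMap-singleton f pL)

  ∈-if-does : ∀ {P : Set} (d : Dec P) {a : A} {X : List A} → a ∈ (if does d then X else []) → P × a ∈ X
  ∈-if-does (yes p) m = p , m

  if-does-∈ : ∀ {P : Set} (d : Dec P) {a : A} {X : List A} → P → a ∈ X → a ∈ (if does d then X else [])
  if-does-∈ (yes _) p m = m
  if-does-∈ (no np) p m = ⊥-elim (np p)

  if-does-no : ∀ {P : Set} (d : Dec P) {X Y : List A} → ¬ P → (if does d then X else Y) ≡ Y
  if-does-no (yes p) np = ⊥-elim (np p)
  if-does-no (no _) np = refl

  ∈-if-bool : ∀ (b : Bool) {a : A} {X : List A} → a ∈ (if b then X else []) → IsTrue b × a ∈ X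
  ∈-if-bool true m = tt , m

  if-bool-∈ : ∀ (b : Bool) {a : A} {X : List A} → IsTrue b → a ∈ X → a ∈ (if b then X else [])
  if-bool-∈ true _ m = m

  AllPairs-if-does : ∀ {P : Set} (d : Dec P) {R : A → A → Set} {X : List A} → AllPairs R X →
                     AllPairs R (if does d then X else [])
  AllPairs-if-does (yes _) ap = ap
  AllPairs-if-does (no _) ap = []

  AllPairs-if-singleton : ∀ (b : Bool) {R : A → A → Set} {x : A} → AllPairs R (if b then [ x ] else [])
  AllPairs-if-singleton true = [] ∷ []
  AllPairs-if-singleton false = []

survives-if-avoids : ∀ {P Q : Set} (d₁ : Dec P) (d₂ : Dec Q) → ¬ P → ¬ Q → IsTrue (if does d₁ ∨ does d₂ then false else true)
survives-if-avoids (yes p) d₂ np nq = ⊥-elim (np p)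
survives-if-avoids (no _) (yes q) np nq = ⊥-elim (nq q)
survives-if-avoids (no _) (no _) np nq = tt

avoids-if-survives : ∀ {P Q : Set} (d₁ : Dec P) (d₂ : Dec Q) → IsTrue (if does d₁ ∨ does d₂ then false else true) → ¬ P × ¬ Q
avoids-if-survives (no np) (no nq) _ = np , nq

module _ {A : Set} where

  precedes-∈ : ∀ {L : List A} {a b} → Precedes L a b → a ∈ L × b ∈ L
  precedes-∈ (L1 , L2 , L3 , refl) = ∈-++⁺ʳ L1 (here refl) , ∈-++⁺ʳ L1 (there (∈-++⁺ʳ L2 (here refl)))

  precedes-∷ : ∀ {x : A} {L a b} → Precedes (x ∷ L) a b → (x ≡ a × b ∈ L) ⊎ Precedes L a b
  precedes-∷ ([] , L2 , L3 , eq) with ∷-injective eq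
  ... | refl , refl = inj₁ (refl , ∈-++⁺ʳ L2 (here refl))
  precedes-∷ (y ∷ L1 , L2 , L3 , eq) with ∷-injective eq
  ... | refl , refl = inj₂ (L1 , L2 , L3 , refl)

  precedes-asym : ∀ {L : List A} {a b} → Unique L → Precedes L a b → Precedes L b a → ⊥
  precedes-asym {[]} u p q with precedes-∈ p
  ... | () , _
  precedes-asym {x ∷ L} (x∉L ∷ u) p q with precedes-∷ p | precedes-∷ q
  ... | inj₁ (refl , b∈) | inj₁ (refl , _) = All.lookup x∉L b∈ refl
  ... | inj₁ (refl , b∈) | inj₂ q' = All.lookup x∉L (proj₂ (precedes-∈ q')) refl
  ... | inj₂ p' | inj₁ (refl , a∈) = All.lookup x∉L (proj₂ (precedes-∈ p')) refl
  ... | inj₂ p' | inj₂ q' = precedes-asym u p' q'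

  sorted-by-precedes : ∀ (pre xs : List A) → AllPairs (Precedes (pre ++ xs)) xs
  sorted-by-precedes pre [] = []
  sorted-by-precedes pre (x ∷ xs) =
    All.tabulate later ∷ subst (λ L → AllPairs (Precedes L) xs) (++-assoc pre [ x ] xs) (sorted-by-precedes (pre ++ [ x ]) xs)
    where
      later : ∀ {y} → y ∈ xs → Precedes (pre ++ x ∷ xs) x y
      later y∈ with ∈-∃++ y∈
      ... | ys , zs , eq = pre , ys , zs , cong (λ t → pre ++ x ∷ t) eq

Crosses : ∀ {ℓ r} → Fin ℓ → Fin r → Fin ℓ → Fin r → Set
Crosses p q p' q' = (toℕ p' < toℕ p × toℕ q < toℕ q') ⊎ (toℕ p < toℕ p' × toℕ q' < toℕ q)

-- Walking along the
-- tree path from a vertex x to q, the invariant `Φ x` says: if x lies below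
-- (above) p resp. q, then q has a tree neighbour below (above) p; and a left
-- vertex on the walk is never p itself.
module NoncrossingWalk {ℓ r} (T : List (Fin ℓ × Fin r)) (nc : NonCrossing T) (p : Fin ℓ) (q : Fin r)
                       (npq : ¬ (p , q) ∈ T) (noX : ∀ p' q' → (p' , q') ∈ T → Crosses p q p' q' → ⊥) where

  Below Above : Set
  Below = ∃ λ a → toℕ a < toℕ p × (a , q) ∈ T
  Above = ∃ λ a → toℕ p < toℕ a × (a , q) ∈ T

  Φ : Fin ℓ ⊎ Fin r → Set
  Φ (inj₁ a) = (toℕ a < toℕ p → Below) × (toℕ p < toℕ a → Above) × (toℕ a ≢ toℕ p)
  Φ (inj₂ b) = (toℕ b < toℕ q → Below) × (toℕ q < toℕ b → Above)

  step-left : ∀ {a b} → (a , b) ∈ T → Φ (inj₂ b) → Φ (inj₁ a)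
  step-left {a} {b} m (below , above) = fromLeft-below , fromLeft-above , notP
    where
      fromLeft-below : toℕ a < toℕ p → Below
      fromLeft-below a<p with NP.<-cmp (toℕ b) (toℕ q)
      ... | tri< b<q _ _ = below b<q
      ... | tri≈ _ b=q _ = a , a<p , subst (λ z → (a , z) ∈ T) (FP.toℕ-injective b=q) m
      ... | tri> _ _ q<b = ⊥-elim (noX a b m (inj₁ (a<p , q<b)))
      fromLeft-above : toℕ p < toℕ a → Above
      fromLeft-above p<a with NP.<-cmp (toℕ b) (toℕ q)
      ... | tri< b<q _ _ = ⊥-elim (noX a b m (inj₂ (p<a , b<q)))
      ... | tri≈ _ b=q _ = a , p<a , subst (λ z → (a , z) ∈ T) (FP.toℕ-injective b=q) m
      ... | tri> _ _ q<b = above q<b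
      -- if a were p, its edge to b would cross q's neighbour on the other side
      notP : toℕ a ≢ toℕ p
      notP a=p with FP.toℕ-injective a=p
      ... | refl with NP.<-cmp (toℕ b) (toℕ q)
      ...   | tri< b<q _ _ with below b<q
      ...     | a' , a'<p , m' = nc a' q a b m' m a'<p b<q
      notP a=p | refl | tri≈ _ b=q _ = npq (subst (λ z → (a , z) ∈ T) (FP.toℕ-injective b=q) m)
      notP a=p | refl | tri> _ _ q<b with above q<b
      ...     | a' , p<a' , m' = nc a b a' q m m' p<a' q<b

  step-right : ∀ {a b} → (a , b) ∈ T → Φ (inj₁ a) → Φ (inj₂ b)
  step-right {a} {b} m (below , above , notP) = fromRight-below , fromRight-above
    where
      fromRight-below : toℕ b < toℕ q → Below
      fromRight-below b<q with NP.<-cmp (toℕ a) (toℕ p)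
      ... | tri< a<p _ _ = below a<p
      ... | tri≈ _ a=p _ = ⊥-elim (notP a=p)
      ... | tri> _ _ p<a = ⊥-elim (noX a b m (inj₂ (p<a , b<q)))
      fromRight-above : toℕ q < toℕ b → Above
      fromRight-above q<b with NP.<-cmp (toℕ a) (toℕ p)
      ... | tri< a<p _ _ = ⊥-elim (noX a b m (inj₁ (a<p , q<b)))
      ... | tri≈ _ a=p _ = ⊥-elim (notP a=p)
      ... | tri> _ _ p<a = above p<a

  walk : ∀ {x} → Star (BAdj T) x (inj₂ q) → Φ x
  walk ε = (λ lt → ⊥-elim (NP.<-irrefl refl lt)) , (λ lt → ⊥-elim (NP.<-irrefl refl lt))
  walk (lr m ◅ w) = step-left m (walk w)
  walk (rl m ◅ w) = step-right m (walk w)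

-- The walk from p itself contradicts `toℕ p ≢ toℕ p`.
missing-edge-is-crossed : ∀ {ℓ r} (T : List (Fin ℓ × Fin r)) → IsNCTree T → ∀ p q → ¬ (p , q) ∈ T →
  (∀ p' q' → (p' , q') ∈ T → Crosses p q p' q' → ⊥) → ⊥
missing-edge-is-crossed T ((_ , _ , connected) , nc) p q npq noX =
  proj₂ (proj₂ (walk (connected (inj₁ p) (inj₂ q)))) refl
  where open NoncrossingWalk T nc p q npq noX

left-vertex-covered : ∀ {ℓ r} (T : List (Fin ℓ × Fin r)) → IsNCTree T → ∀ p (q₀ : Fin r) → ∃ λ q → (p , q) ∈ T
left-vertex-covered T ((_ , _ , connected) , _) p q₀ with connected (inj₁ p) (inj₂ q₀)
... | lr m ◅ _ = _ , m

module Reductions {n : ℕ} (G : FramedGraph n) (FG : IsFramedGraph G) where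
  open FramedGraph G

  Seq : Set
  Seq = List (Fin m)

  src<tgt : ∀ e → src e < tgt e
  src<tgt e = proj₁ (proj₂ (proj₁ FG e))

  tgt≤n : ∀ e → tgt e ≤ n
  tgt≤n e = proj₂ (proj₂ (proj₁ FG e))

  1≤src : ∀ e → 1 ≤ src e
  1≤src e = proj₁ (proj₁ FG e)

  2≤tgt : ∀ e → 2 ≤ tgt e
  2≤tgt e = NP.≤-trans (s≤s (1≤src e)) (src<tgt e)

  hasInOut : ∀ v → Inner G v → (∃ λ e → tgt e ≡ v) × (∃ λ e → src e ≡ v)
  hasInOut = proj₁ (proj₂ (proj₂ FG))

  inFrOK : ∀ v → Inner G v → Unique (inFr v) × (∀ e → (e ∈ inFr v) ⇔ (tgt e ≡ v))
  inFrOK = proj₁ (proj₂ (proj₂ (proj₂ FG)))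

  outFrOK : ∀ v → Inner G v → Unique (outFr v) × (∀ e → (e ∈ outFr v) ⇔ (src e ≡ v))
  outFrOK = proj₂ (proj₂ (proj₂ (proj₂ FG)))

  path-src : ∀ {a x b} → Path G a x b → pathSrc G x ≡ a
  path-src (edge e) = refl
  path-src (cons e p) = refl

  path-tgt : ∀ {a x b} → Path G a x b → pathTgt G x ≡ b
  path-tgt (edge e) = refl
  path-tgt {x = _ ∷ []} (cons e ())
  path-tgt {x = _ ∷ _ ∷ _} (cons e p) = path-tgt p

  path-lt : ∀ {a x b} → Path G a x b → a < b
  path-lt (edge e) = src<tgt e
  path-lt (cons e p) = NP.<-trans (src<tgt e) (path-lt p)

  path-tgt-le : ∀ {a x b} → Path G a x b → ∀ {e} → e ∈ x → tgt e ≤ b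
  path-tgt-le (edge e) (here refl) = NP.≤-refl
  path-tgt-le (cons e p) (here refl) = NP.<⇒≤ (path-lt p)
  path-tgt-le (cons e p) (there k) = path-tgt-le p k

  path-le-n : ∀ {a x b} → Path G a x b → b ≤ n
  path-le-n (edge e) = tgt≤n e
  path-le-n (cons e p) = path-le-n p

  path-snoc : ∀ {a x b e} → Path G a x b → src e ≡ b → Path G a (x ++ [ e ]) (tgt e)
  path-snoc {e = e} (edge f) eq = cons f (subst (λ v → Path G v [ e ] (tgt e)) eq (edge e))
  path-snoc (cons f p) eq = cons f (path-snoc p eq)

  path-junction : ∀ {a c f y} (x : Seq) → x ≢ [] → Path G a (x ++ f ∷ y) c → src f ≡ pathTgt G x
  path-junction [] ne p = ⊥-elim (ne refl)
  path-junction (x0 ∷ []) ne (cons .x0 p) = path-src p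
  path-junction (x0 ∷ x1 ∷ x) ne (cons .x0 p) = path-junction (x1 ∷ x) (λ ()) p

  -- a route cannot be properly extended: nothing leaves n
  route-maximal : ∀ {R g k} → Route G R → R ≡ g ++ k → g ≢ [] → Route G g → k ≡ []
  route-maximal {k = []} route eR ne rg = refl
  route-maximal {g = g} {k = f ∷ k} route eR ne rg =
    ⊥-elim (NP.<-irrefl refl (NP.<-≤-trans (src<tgt f) (NP.≤-trans (tgt≤n f) (NP.≤-reflexive (sym src-f)))))
    where src-f : src f ≡ n
          src-f = trans (path-junction g ne (subst (λ z → Path G 1 z n) eR route)) (path-tgt rg)

  pathTgt-snoc : (x : Seq) (e : Fin m) → pathTgt G (x ++ [ e ]) ≡ tgt e
  pathTgt-snoc [] e = refl
  pathTgt-snoc (a ∷ []) e = refl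
  pathTgt-snoc (a ∷ b ∷ x) e = pathTgt-snoc (b ∷ x) e

  pathSrc-++ : (x y : Seq) → x ≢ [] → pathSrc G (x ++ y) ≡ pathSrc G x
  pathSrc-++ [] y ne = ⊥-elim (ne refl)
  pathSrc-++ (a ∷ x) y ne = refl

  src≡1⇒nonempty : ∀ (g : Seq) → pathSrc G g ≡ 1 → g ≢ []
  src≡1⇒nonempty [] () refl
  src≡1⇒nonempty (_ ∷ _) _ ()

  single-path : ∀ e → src e ≡ 1 → Path G 1 [ e ] (tgt e)
  single-path e eq = subst (λ a → Path G a [ e ] (tgt e)) eq (edge e)

  path-ends : ∀ {a x b} → Path G a x b → EndsAt G x b
  path-ends (edge e) = [] , e , refl , refl
  path-ends (cons e p) with path-ends p
  ... | P' , f , eq , t = e ∷ P' , f , cong (e ∷_) eq , t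

  ends-unique : ∀ {x v w} → EndsAt G x v → EndsAt G x w → v ≡ w
  ends-unique (P , e , eq , t) (P' , e' , eq' , t') with ∷ʳ-injectiveʳ P P' (trans (sym eq) eq')
  ... | refl = trans (sym t) t'

  ends-nonempty : ∀ {v} → EndsAt G [] v → ⊥
  ends-nonempty ([] , e , () , _)
  ends-nonempty (_ ∷ _ , e , () , _)

  ends-suffix : ∀ {v} (a b c : Seq) → b ≢ [] → EndsAt G (a ++ b) v → EndsAt G (c ++ b) v
  ends-suffix a b c ne (P , e , eq , t) with init-last b ne
  ... | b' , f , refl with ∷ʳ-injectiveʳ (a ++ b') P (trans (++-assoc a b' [ f ]) eq)
  ...   | refl = c ++ b' , f , sym (++-assoc c b' [ f ]) , t

  ends-shift : ∀ {i v} ga gx ha → EndsAt G (ga ++ gx) i → EndsAt G ga v → EndsAt G ha v → EndsAt G (ha ++ gx) i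
  ends-shift {i} ga [] ha ex ega eha rewrite ++-identityʳ ga | ++-identityʳ ha | ends-unique ex ega = eha
  ends-shift ga gx@(_ ∷ _) ha ex ega eha = ends-suffix ga gx ha (λ ()) ex

  single-tail : ∀ {e₀ v} (a b : Seq) → [ e₀ ] ≡ a ++ b → EndsAt G a v → b ≡ []
  single-tail a b eq en with singleton-split a b eq
  ... | inj₁ refl = ⊥-elim (ends-nonempty en)
  ... | inj₂ p = p

  InLess-++ʳ : ∀ {x y} → InLess G x y → (c : Seq) → InLess G (x ++ c) (y ++ c)
  InLess-++ʳ (A , B , e , f , C , px , py , ne , pr) c =
    A , B , e , f , C ++ c , trans (cong (_++ c) px) (++-assoc A (e ∷ C) c) ,
    trans (cong (_++ c) py) (++-assoc B (f ∷ C) c) , ne , pr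

  InLess-++ˡ : ∀ {x y} → InLess G x y → (u w : Seq) → InLess G (u ++ x) (w ++ y)
  InLess-++ˡ (A , B , e , f , C , px , py , ne , pr) u w =
    u ++ A , w ++ B , e , f , C , trans (cong (u ++_) px) (sym (++-assoc u A (e ∷ C))) ,
    trans (cong (w ++_) py) (sym (++-assoc w B (f ∷ C))) , ne , pr

  InLess-irrefl : ∀ {x} → InLess G x x → ⊥
  InLess-irrefl (A , B , e , f , C , px , py , ne , pr) =
    ne (∷-injectiveˡ (++-cancelˡ (reverse C) _ _
      (trans (sym (reverse-middle A e C)) (trans (cong reverse (trans (sym px) py)) (reverse-middle B f C)))))

  -- asymmetry needs the divergence vertex to be inner, so that its in-framing
  -- is a duplicate-free list
  InLess-asym : ∀ {x y} → (∀ {e} → e ∈ x → tgt e < n) → InLess G x y → InLess G y x → ⊥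
  InLess-asym {x} {y} bnd (A , B , e , f , C , px , py , ne , pr) (A' , B' , e' , f' , C' , py' , px' , ne' , pr')
    with first-divergence (reverse C) (reverse C')
           (trans (sym (reverse-middle A e C)) (trans (cong reverse (trans (sym px) px')) (reverse-middle B' f' C')))
           (trans (sym (reverse-middle B f C)) (trans (cong reverse (trans (sym py) py')) (reverse-middle A' e' C')))
           ne (λ eq → ne' (sym eq))
  ... | _ , refl , refl = precedes-asym unique pr (subst (λ v → Precedes (inFr v) f e) tf pr')
    where
      inner : Inner G (tgt e)
      inner = 2≤tgt e , bnd (subst (e ∈_) (sym px) (∈-++⁺ʳ A (here refl)))
      unique = proj₁ (inFrOK (tgt e) inner)
      tf : tgt f ≡ tgt e
      tf = Equivalence.to (proj₂ (inFrOK (tgt e) inner) f) (proj₂ (precedes-∈ pr))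

  OutLess-nilˡ : ∀ {Q} → OutLess G [] Q → ⊥
  OutLess-nilˡ (C , e , f , A , B , p , q , ne , pr) with ++-conicalʳ C (e ∷ A) (sym p)
  ... | ()

  OutLess-nilʳ : ∀ {P} → OutLess G P [] → ⊥
  OutLess-nilʳ (C , e , f , A , B , p , q , ne , pr) with ++-conicalʳ C (f ∷ B) (sym q)
  ... | ()

  OutLess-splitˡ : ∀ {P} (Q k : Seq) → OutLess G (Q ++ k) P → OutLess G Q P ⊎ ∃ λ r → P ≡ Q ++ r
  OutLess-splitˡ Q k (C , e , f , A , B , p , q , ne , pr) with split-at-∷ C Q e A k (sym p)
  ... | inj₁ (A'' , eq) = inj₁ (C , e , f , A'' , B , eq , q , ne , pr)
  ... | inj₂ (D , eq) = inj₂ (D ++ f ∷ B , trans q (trans (cong (_++ f ∷ B) eq) (++-assoc Q D (f ∷ B))))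

  OutLess-splitʳ : ∀ {P} (Q k : Seq) → OutLess G P (Q ++ k) → OutLess G P Q ⊎ ∃ λ r → P ≡ Q ++ r
  OutLess-splitʳ Q k (C , e , f , A , B , p , q , ne , pr) with split-at-∷ C Q f B k (sym q)
  ... | inj₁ (B'' , eq) = inj₁ (C , e , f , A , B'' , p , eq , ne , pr)
  ... | inj₂ (D , eq) = inj₂ (D ++ e ∷ A , trans p (trans (cong (_++ e ∷ A) eq) (++-assoc Q D (e ∷ A))))

  -- For routes, partial coherence in both
  -- directions is exactly coherence.

  PartiallyCoherent : Seq → Seq → Set
  PartiallyCoherent g h = ∀ ga gb ha hb v → g ≡ ga ++ gb → h ≡ ha ++ hb → EndsAt G ga v → EndsAt G ha v →
                          InLess G ga ha → OutLess G hb gb → ⊥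

  -- `Interior i g`: g only passes through vertices < i (its end is not counted).
  Interior : ℕ → Seq → Set
  Interior i g = ∀ ga gb v → g ≡ ga ++ gb → gb ≢ [] → EndsAt G ga v → v < i

  -- `AvoidsInside i h`: no prefix of h (h itself included) ends at i.
  AvoidsInside : ℕ → Seq → Set
  AvoidsInside i h = ∀ ha hb → h ≡ ha ++ hb → EndsAt G ha i → ⊥

  coherent-from-partial : ∀ {P Q} → PartiallyCoherent P Q → PartiallyCoherent Q P → Coherent G P Q
  coherent-from-partial cPQ cQP v _ Pa Pb Qa Qb eP eQ ePa eQa =
    (λ { (il , ol) → cPQ Pa Pb Qa Qb v eP eQ ePa eQa il ol }) ,
    (λ { (il , ol) → cQP Qa Qb Pa Pb v eQ eP eQa ePa il ol })

  interior-single : ∀ {i} e → Interior i [ e ]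
  interior-single e ga gb v eq ne en = ⊥-elim (ne (single-tail ga gb eq en))

  interior-suc : ∀ {i g} → Interior i g → Interior (suc i) g
  interior-suc it ga gb v eq ne en = NP.m<n⇒m<1+n (it ga gb v eq ne en)

  interior-snoc : ∀ {i x} e → Interior i x → EndsAt G x i → Interior (suc i) (x ++ [ e ])
  interior-snoc e it ex ga [] v eq ne en = ⊥-elim (ne refl)
  interior-snoc {i} e it ex ga gb@(_ ∷ _) v eq ne en with snoc-split ga gb _ e (sym eq) ne
  ... | [] , xeq , _ =
        NP.≤-reflexive (cong suc (ends-unique en (subst (λ z → EndsAt G z i) (trans xeq (++-identityʳ ga)) ex)))
  ... | gx@(_ ∷ _) , xeq , _ = NP.m<n⇒m<1+n (it ga gx v xeq (λ ()) en)

  -- a single edge has no inner vertex, hence is partially coherent with anything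
  single-coherentˡ : ∀ e h → PartiallyCoherent [ e ] h
  single-coherentˡ e h ga gb ha hb v eg eh ega eha il ol with single-tail ga gb eg ega
  ... | refl = OutLess-nilʳ ol

  single-coherentʳ : ∀ g e → PartiallyCoherent g [ e ]
  single-coherentʳ g e ga gb ha hb v eg eh ega eha il ol with single-tail ha hb eh eha
  ... | refl = OutLess-nilˡ ol

  -- Extending x (ending at i) by an edge keeps partial coherence with an h
  -- avoiding i: a new witness would need h to pass through i.
  coherent-extendˡ : ∀ {i} x e h → PartiallyCoherent x h → EndsAt G x i → AvoidsInside i h →
                     PartiallyCoherent (x ++ [ e ]) h
  coherent-extendˡ x e h cxh ex av ga [] ha hb v eg eh ega eha il ol = OutLess-nilʳ ol
  coherent-extendˡ x e h cxh ex av ga gb@(_ ∷ _) ha hb v eg eh ega eha il ol with snoc-split ga gb x e (sym eg) (λ ())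
  ... | gx , xeq , gbeq with OutLess-splitʳ gx [ e ] (subst (OutLess G hb) gbeq ol)
  ...   | inj₁ ol' = cxh ga gx ha hb v xeq eh ega eha il ol'
  ...   | inj₂ (r , hbeq) = av (ha ++ gx) r (trans eh (trans (cong (ha ++_) hbeq) (sym (++-assoc ha gx r))))
                               (ends-shift ga gx ha (subst (λ z → EndsAt G z _) xeq ex) ega eha)

  coherent-extendʳ : ∀ {i} x e h → PartiallyCoherent h x → EndsAt G x i → AvoidsInside i h →
                     PartiallyCoherent h (x ++ [ e ])
  coherent-extendʳ x e h chx ex av ga gb ha [] v eg eh ega eha il ol = OutLess-nilˡ ol
  coherent-extendʳ x e h chx ex av ga gb ha hb@(_ ∷ _) v eg eh ega eha il ol with snoc-split ha hb x e (sym eh) (λ ())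
  ... | hx , xeq , hbeq with OutLess-splitˡ hx [ e ] (subst (λ z → OutLess G z gb) hbeq ol)
  ...   | inj₁ ol' = chx ga gb ha hx v eg xeq ega eha il ol'
  ...   | inj₂ (r , gbeq) = av (ga ++ hx) r (trans eg (trans (cong (ga ++_) gbeq) (sym (++-assoc ga hx r))))
                               (ends-shift ha hx ga (subst (λ z → EndsAt G z _) xeq ex) eha ega)

  -- Extending two paths x, y that both end at i and have inner vertices < i:
  -- a new witness of incoherence can only sit at i itself, comparing x with y
  -- and e with e'; the hypothesis `atI` excludes exactly that.
  coherent-extend-both : ∀ {i} x e y e' → PartiallyCoherent x y → EndsAt G x i → EndsAt G y i →
    Interior i x → Interior i y → (InLess G x y → e' ≢ e → Precedes (outFr (src e')) e' e → ⊥) →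
    PartiallyCoherent (x ++ [ e ]) (y ++ [ e' ])
  coherent-extend-both x e y e' cxy ex ey ix iy atI ga [] ha hb v eg eh ega eha il ol = OutLess-nilʳ ol
  coherent-extend-both x e y e' cxy ex ey ix iy atI ga (_ ∷ _) ha [] v eg eh ega eha il ol = OutLess-nilˡ ol
  coherent-extend-both {i} x e y e' cxy ex ey ix iy atI ga gb@(_ ∷ _) ha hb@(_ ∷ _) v eg eh ega eha il
            (C , a , b , A , B , p1 , p2 , ne , pr)
    with snoc-split ga gb x e (sym eg) (λ ()) | snoc-split ha hb y e' (sym eh) (λ ())
  ... | gx , xeq , gbeq | hy , yeq , hbeq
    with split-at-∷ C hy a A [ e' ] (sym (trans (sym hbeq) p1)) | split-at-∷ C gx b B [ e ] (sym (trans (sym gbeq) p2))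
  ... | inj₁ (A'' , hyeq) | inj₁ (B'' , gxeq) = cxy ga gx ha hy v xeq yeq ega eha il (C , a , b , A'' , B'' , hyeq , gxeq , ne , pr)
  ... | inj₁ (A'' , hyeq) | inj₂ (D' , refl) =
        NP.<-irrefl refl (iy (ha ++ gx) (D' ++ a ∷ A'') i yeq' (++-∷-nonempty D')
          (ends-shift ga gx ha (subst (λ z → EndsAt G z i) xeq ex) ega eha))
    where
      yeq' : y ≡ (ha ++ gx) ++ (D' ++ a ∷ A'')
      yeq' = trans yeq (trans (cong (ha ++_) (trans hyeq (++-assoc gx D' (a ∷ A'')))) (sym (++-assoc ha gx _)))
  ... | inj₂ (D , refl) | inj₁ (B'' , gxeq) =
        NP.<-irrefl refl (ix (ga ++ hy) (D ++ b ∷ B'') i xeq' (++-∷-nonempty D)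
          (ends-shift ha hy ga (subst (λ z → EndsAt G z i) yeq ey) eha ega))
    where
      xeq' : x ≡ (ga ++ hy) ++ (D ++ b ∷ B'')
      xeq' = trans xeq (trans (cong (ga ++_) (trans gxeq (++-assoc hy D (b ∷ B'')))) (sym (++-assoc ga hy _)))
  ... | inj₂ (D , ceq) | inj₂ (D' , ceq')
    with singleton-as-∷ D A (++-cancelˡ hy _ _ (trans (sym hbeq) (trans p1 (trans (cong (_++ a ∷ A) ceq) (++-assoc hy D (a ∷ A))))))
       | singleton-as-∷ D' B (++-cancelˡ gx _ _ (trans (sym gbeq) (trans p2 (trans (cong (_++ b ∷ B) ceq') (++-assoc gx D' (b ∷ B))))))
  ...   | refl , refl | refl , refl = atI (subst₂ (InLess G) (sym xC) (sym yC) (InLess-++ʳ il C)) ne pr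
    where
      xC : x ≡ ga ++ C
      xC = trans xeq (cong (ga ++_) (trans (sym (++-identityʳ gx)) (sym ceq')))
      yC : y ≡ ha ++ C
      yC = trans yeq (cong (ha ++_) (trans (sym (++-identityʳ hy)) (sym ceq)))

  GoodIn : ℕ → ℕ → Seq → Set
  GoodIn i j x = (Σ (Fin m) λ e → x ≡ [ e ] × tgt e ≡ j × i ≤ src e) ⊎ Path G 1 x j

  GoodEdge : ℕ → Seq → Set
  GoodEdge i g = (Σ (Fin m) λ e → g ≡ [ e ] × i ≤ src e) ⊎ (Σ ℕ λ b → Path G 1 g b × i ≤ b × Interior i g)

  OutOrdered : ℕ → Seq → Seq → Set
  OutOrdered j x y = Σ (Fin m) λ e → Σ (Fin m) λ e' → x ≡ [ e ] × y ≡ [ e' ] × e ≢ e' × Precedes (outFr j) e e'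

  record Inv (i : ℕ) (s : State G) : Set where
    field
      2≤i       : 2 ≤ i
      outSingle : ∀ j → i ≤ j → j < n → All (λ x → Σ (Fin m) λ e → x ≡ [ e ] × src e ≡ j) (State.outO s j)
      outSorted : ∀ j → i ≤ j → j < n → AllPairs (OutOrdered j) (State.outO s j)
      outAll    : ∀ j → i ≤ j → j < n → ∀ e → src e ≡ j → [ e ] ∈ State.outO s j
      inGood    : ∀ j → i ≤ j → j < n → All (GoodIn i j) (State.inO s j)
      inSorted  : ∀ j → i ≤ j → j < n → AllPairs (InLess G) (State.inO s j)
      inAll     : ∀ j → i ≤ j → j < n → ∀ x → x ∈ State.edges s → pathTgt G x ≡ j → x ∈ State.inO s j
      inEdges   : ∀ j → i ≤ j → j < n → ∀ x → x ∈ State.inO s j → x ∈ State.edges s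
      edgeGood  : ∀ g → g ∈ State.edges s → GoodEdge i g
      edgeKept  : ∀ e → i ≤ src e → [ e ] ∈ State.edges s
      edgeCoh   : ∀ g h → g ∈ State.edges s → h ∈ State.edges s → PartiallyCoherent g h

  ≢1⇒2≤ : ∀ {a} → 1 ≤ a → a ≢ 1 → 2 ≤ a
  ≢1⇒2≤ le ne = NP.≤∧≢⇒< le (λ eq → ne (sym eq))

  inv-init : Inv 2 (initState G)
  inv-init = record
    { 2≤i = NP.≤-refl
    ; outSingle = λ j a b → AllP.map⁺ (All.tabulate (λ {e} e∈ → e , refl , Equivalence.to (outSpec j a b e) e∈))
    ; outSorted = λ j a b → APP.map⁺ (AP.map (λ {x} {y} p → x , y , refl , refl , p)
                            (AP.zip (proj₁ (outFrOK j (a , b)) , sorted-by-precedes [] (outFr j))))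
    ; outAll = λ j a b e eq → ∈-map⁺ [_] (Equivalence.from (outSpec j a b e) eq)
    ; inGood = λ j a b → AllP.map⁺ (All.tabulate (λ {e} e∈ → good j e (Equivalence.to (inSpec j a b e) e∈)))
    ; inSorted = λ j a b → APP.map⁺ (AP.map (λ {x} {y} p → single-InLess j a b x y p)
                           (AP.zip (proj₁ (inFrOK j (a , b)) , sorted-by-precedes [] (inFr j))))
    ; inAll = inAll
    ; inEdges = λ j a b x x∈ → inEdges j x x∈
    ; edgeGood = edgeGood
    ; edgeKept = λ e _ → ∈-map⁺ [_] (∈-allFin e)
    ; edgeCoh = edgeCoh
    }
    where
      inSpec : ∀ j → 2 ≤ j → j < n → ∀ e → (e ∈ inFr j) ⇔ (tgt e ≡ j)
      inSpec j a b = proj₂ (inFrOK j (a , b))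
      outSpec : ∀ j → 2 ≤ j → j < n → ∀ e → (e ∈ outFr j) ⇔ (src e ≡ j)
      outSpec j a b = proj₂ (outFrOK j (a , b))
      good : ∀ j e → tgt e ≡ j → GoodIn 2 j [ e ]
      good j e t with src e N.≟ 1
      ... | yes eq = inj₂ (subst (Path G 1 [ e ]) t (single-path e eq))
      ... | no ne = inj₁ (e , refl , t , ≢1⇒2≤ (1≤src e) ne)
      single-InLess : ∀ j → 2 ≤ j → j < n → ∀ x y → x ≢ y × Precedes (inFr j) x y → InLess G [ x ] [ y ]
      single-InLess j a b x y (ne , pr) = [] , [] , x , y , [] , refl , refl , ne ,
        subst (λ v → Precedes (inFr v) x y) (sym (Equivalence.to (inSpec j a b x) (proj₁ (precedes-∈ pr)))) pr
      inAll : ∀ j → 2 ≤ j → j < n → ∀ x → x ∈ State.edges (initState G) → pathTgt G x ≡ j → x ∈ State.inO (initState G) j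
      inAll j a b x x∈ t with ∈-map⁻ [_] x∈
      ... | e , _ , refl = ∈-map⁺ [_] (Equivalence.from (inSpec j a b e) t)
      inEdges : ∀ j x → x ∈ State.inO (initState G) j → x ∈ State.edges (initState G)
      inEdges j x x∈ with ∈-map⁻ [_] x∈
      ... | e , _ , refl = ∈-map⁺ [_] (∈-allFin e)
      edgeGood : ∀ g → g ∈ State.edges (initState G) → GoodEdge 2 g
      edgeGood g g∈ with ∈-map⁻ [_] g∈
      ... | e , _ , refl with src e N.≟ 1
      ...   | yes eq = inj₂ (tgt e , single-path e eq , 2≤tgt e , interior-single e)
      ...   | no ne = inj₁ (e , refl , ≢1⇒2≤ (1≤src e) ne)
      edgeCoh : ∀ g h → g ∈ State.edges (initState G) → h ∈ State.edges (initState G) → PartiallyCoherent g h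
      edgeCoh g h g∈ h∈ with ∈-map⁻ [_] g∈
      ... | e , _ , refl = single-coherentˡ e h

  module Step (s : State G) (i : ℕ) (T : TreeAt G s i) (inv : Inv i s) (i<n : i < n) (ncT : IsNCTree T) where
    open Inv inv

    I O : List Seq
    I = State.inO s i
    O = State.outO s i

    ℓ r : ℕ
    ℓ = length I
    r = length O

    s' : State G
    s' = reduce G s i T

    i≤i : i ≤ i
    i≤i = NP.≤-refl

    inner-i : Inner G i
    inner-i = 2≤i , i<n

    newEdge : Fin ℓ × Fin r → Seq
    newEdge (p , q) = lookup I p ++ lookup O q

    keep : Seq → Bool
    keep g = if does (pathSrc G g N.≟ i) ∨ does (pathTgt G g N.≟ i) then false else true

    throughTree : Seq → List Seq
    throughTree g = concatMap (λ q → if does (_≟ᴸ_ G (lookup O q) g)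
                 then concatMap (λ p → if inTree T p q then [ lookup I p ++ lookup O q ] else []) (allFin ℓ)
                 else []) (allFin r)

    expand : (g : Seq) → Dec (pathSrc G g ≡ i) → List Seq
    expand g d = if does d then throughTree g else [ g ]

    expandIn : Seq → List Seq
    expandIn g = expand g (pathSrc G g N.≟ i)

    inO-reduced : ∀ j → j ≢ i → State.inO s' j ≡ concatMap expandIn (State.inO s j)
    inO-reduced j ne = if-does-no (j N.≟ i) ne

    lt⇒≢ : ∀ {j} → i < j → j ≢ i
    lt⇒≢ lt eq = NP.<-irrefl (sym eq) lt

    -- out-framings after i only contain original edges, which are untouched
    outO-reduced : ∀ j → i < j → j < n → State.outO s' j ≡ State.outO s j
    outO-reduced j a b = trans (if-does-no (j N.≟ i) (lt⇒≢ a))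
      (concatMap-singleton _ (All.map (λ { {x} (e , refl , se) → if-does-no (pathTgt G [ e ] N.≟ i)
         (λ eq → lt⇒≢ (NP.<-trans a (subst (_< tgt e) se (src<tgt e))) eq) }) (outSingle j (NP.<⇒≤ a) b)))

    I-path : ∀ p → Path G 1 (lookup I p) i
    I-path p with All.lookup (inGood i i≤i i<n) (∈-lookup p)
    ... | inj₁ (e , eq , t , le) = ⊥-elim (NP.<-irrefl refl (NP.≤-<-trans le (subst (src e <_) t (src<tgt e))))
    ... | inj₂ pth = pth

    I-edges : ∀ p → lookup I p ∈ State.edges s
    I-edges p = inEdges i i≤i i<n _ (∈-lookup p)

    I-interior : ∀ p → Interior i (lookup I p)
    I-interior p with edgeGood (lookup I p) (I-edges p)
    ... | inj₁ (e , eq , le) = ⊥-elim (NP.<-irrefl refl (NP.≤-trans 2≤i (NP.≤-trans le (NP.≤-reflexive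
             (trans (sym (cong (pathSrc G) eq)) (path-src (I-path p)))))))
    ... | inj₂ (_ , _ , _ , it) = it

    I-ends : ∀ p → EndsAt G (lookup I p) i
    I-ends p = path-ends (I-path p)

    I-bounded : ∀ p {e} → e ∈ lookup I p → tgt e < n
    I-bounded p m = NP.≤-<-trans (path-tgt-le (I-path p) m) i<n

    O-single : ∀ q → Σ (Fin m) λ e → lookup O q ≡ [ e ] × src e ≡ i
    O-single q = All.lookup (outSingle i i≤i i<n) (∈-lookup q)

    outEdge : Fin r → Fin m
    outEdge q = proj₁ (O-single q)

    O-outEdge : ∀ q → lookup O q ≡ [ outEdge q ]
    O-outEdge q = proj₁ (proj₂ (O-single q))

    src-outEdge : ∀ q → src (outEdge q) ≡ i
    src-outEdge q = proj₂ (proj₂ (O-single q))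

    O-ordered : ∀ {q q'} → toℕ q < toℕ q' → OutOrdered i (lookup O q) (lookup O q')
    O-ordered = lookup-AllPairs (outSorted i i≤i i<n)

    O-injective : ∀ {q q'} → lookup O q ≡ lookup O q' → q ≡ q'
    O-injective {q} {q'} eq with NP.<-cmp (toℕ q) (toℕ q')
    ... | tri< lt _ _ with O-ordered lt
    ...   | e , e' , eq1 , eq2 , ne , _ = ⊥-elim (ne (∷-injectiveˡ (trans (sym eq1) (trans eq eq2))))
    O-injective {q} {q'} eq | tri≈ _ t _ = FP.toℕ-injective t
    O-injective {q} {q'} eq | tri> _ _ gt with O-ordered gt
    ...   | e , e' , eq1 , eq2 , ne , _ = ⊥-elim (ne (∷-injectiveˡ (trans (sym eq1) (trans (sym eq) eq2))))

    I-less : ∀ {p p'} → toℕ p < toℕ p' → InLess G (lookup I p) (lookup I p')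
    I-less = lookup-AllPairs (inSorted i i≤i i<n)

    O-less : ∀ {q q'} → toℕ q < toℕ q' → ∀ u w → OutLess G (lookup O q ++ u) (lookup O q' ++ w)
    O-less lt u w with O-ordered lt
    ... | c , c' , eq1 , eq2 , ne , pr =
          [] , c , c' , u , w , cong (_++ u) eq1 , cong (_++ w) eq2 , ne ,
          subst (λ v → Precedes (outFr v) c c') (sym src-c) pr
      where src-c : src c ≡ i
            src-c = Equivalence.to (proj₂ (outFrOK i inner-i) c) (proj₁ (precedes-∈ pr))

    treeEdge? : ∀ p q → Dec (Any (_≡ (p , q)) T)
    treeEdge? p q = any? (λ x → PP.≡-dec FP._≟_ FP._≟_ x (p , q)) T

    inTree⁻ : ∀ p q → IsTrue (inTree T p q) → (p , q) ∈ T
    inTree⁻ p q h = Any.map sym (toWitness (subst IsTrue (sym (isYes≗does (treeEdge? p q))) h))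

    inTree⁺ : ∀ {p q} → (p , q) ∈ T → IsTrue (inTree T p q)
    inTree⁺ {p} {q} m = subst IsTrue (isYes≗does (treeEdge? p q)) (fromWitness (Any.map sym m))

    self-∈-expand : ∀ g d → ¬ (pathSrc G g ≡ i) → g ∈ expand g d
    self-∈-expand g (yes eq) ne = ⊥-elim (ne eq)
    self-∈-expand g (no _) ne = here refl

    ∈-expand : ∀ g d {a} → a ∈ expand g d → (¬ (pathSrc G g ≡ i) × a ≡ g) ⊎
             (pathSrc G g ≡ i × Σ (Fin ℓ) λ p → Σ (Fin r) λ q → a ≡ newEdge (p , q) × lookup O q ≡ g × (p , q) ∈ T)
    ∈-expand g (no ne) (here eq) = inj₁ (ne , eq)
    ∈-expand g (yes eq) m with ∈-concatMap-allFin⁻ _ m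
    ... | q , m1 with ∈-if-does (_≟ᴸ_ G (lookup O q) g) m1
    ...   | oq , m2 with ∈-concatMap-allFin⁻ _ m2
    ...     | p , m3 with ∈-if-bool (inTree T p q) m3
    ...       | it , here a≡ = inj₂ (eq , p , q , a≡ , oq , inTree⁻ p q it)

    newEdge-∈-expand : ∀ g d p q → pathSrc G g ≡ i → (p , q) ∈ T → lookup O q ≡ g → newEdge (p , q) ∈ expand g d
    newEdge-∈-expand g (no ne) p q eq pq oq = ⊥-elim (ne eq)
    newEdge-∈-expand g (yes _) p q eq pq oq =
      ∈-concatMap-allFin⁺ _ q (if-does-∈ (_≟ᴸ_ G (lookup O q) g) oq
        (∈-concatMap-allFin⁺ (λ p → if inTree T p q then [ lookup I p ++ lookup O q ] else []) p
          (if-bool-∈ (inTree T p q) (inTree⁺ pq) (here refl))))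

    expand-suffix : ∀ g d {a} → a ∈ expand g d → ∃ λ u → a ≡ u ++ g
    expand-suffix g d m with ∈-expand g d m
    ... | inj₁ (_ , eq) = [] , eq
    ... | inj₂ (_ , p , q , eq , oq , _) = lookup I p , trans eq (cong (lookup I p ++_) oq)

    -- The expansion of g is sorted: the new edges through the same O-edge are
    -- listed by increasing left vertex, i.e. by increasing I-edge.
    expand-sorted : ∀ g d → AllPairs (InLess G) (expand g d)
    expand-sorted g (no _) = [] ∷ []
    expand-sorted g (yes _) = AllPairs-concatMap-allFin _ perOutEdge distinctOutEdges
      where
        column : Fin r → Fin ℓ → List Seq
        column q p = if inTree T p q then [ lookup I p ++ lookup O q ] else []
        block : Fin r → List Seq
        block q = if does (_≟ᴸ_ G (lookup O q) g) then concatMap (column q) (allFin ℓ) else []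
        sameOutEdge : ∀ q {p p'} → toℕ p < toℕ p' → ∀ {a b} → a ∈ column q p → b ∈ column q p' → InLess G a b
        sameOutEdge q {p} {p'} lt am bm with ∈-if-bool (inTree T p q) am | ∈-if-bool (inTree T p' q) bm
        ... | _ , here refl | _ , here refl = InLess-++ʳ (I-less lt) (lookup O q)
        perOutEdge : ∀ q → AllPairs (InLess G) (block q)
        perOutEdge q = AllPairs-if-does (_≟ᴸ_ G (lookup O q) g)
                 (AllPairs-concatMap-allFin (column q) (λ p → AllPairs-if-singleton (inTree T p q))
                   (λ lt → All.tabulate (λ am → All.tabulate (λ bm → sameOutEdge q lt am bm))))
        -- only the block of the (unique) O-edge equal to g is nonempty
        distinctOutEdges : ∀ {q q'} → q F.< q' → All (λ a → All (InLess G a) (block q')) (block q)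
        distinctOutEdges {q} {q'} lt = All.tabulate (λ am → All.tabulate (λ bm →
          ⊥-elim (NP.<-irrefl (cong toℕ (O-injective (trans (proj₁ (∈-if-does (_≟ᴸ_ G (lookup O q) g) am))
                                               (sym (proj₁ (∈-if-does (_≟ᴸ_ G (lookup O q') g) bm)))))) lt)))

    -- The inherited in-framing at j > i is sorted: within one expansion by
    -- `expand-sorted`, across expansions because appending on the left
    -- preserves InLess.
    inO-sorted : ∀ j → i ≤ j → j < n → AllPairs (InLess G) (concatMap expandIn (State.inO s j))
    inO-sorted j a b = APP.concat⁺ (AllP.map⁺ (All.tabulate (λ {g} _ → expand-sorted g (pathSrc G g N.≟ i))))
      (APP.map⁺ (AP.map (λ {g} {g'} lt → All.tabulate (λ {x} xm → All.tabulate (λ {y} ym → across g g' lt xm ym)))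
                 (inSorted j a b)))
      where
        across : ∀ g g' → InLess G g g' → ∀ {x y} → x ∈ expandIn g → y ∈ expandIn g' → InLess G x y
        across g g' lt xm ym with expand-suffix g (pathSrc G g N.≟ i) xm | expand-suffix g' (pathSrc G g' N.≟ i) ym
        ... | u , refl | w , refl = InLess-++ˡ lt u w

    reduced-edge-cases : ∀ {g} → g ∈ State.edges s' →
      (g ∈ State.edges s × ¬ (pathSrc G g ≡ i) × ¬ (pathTgt G g ≡ i)) ⊎
      (Σ (Fin ℓ) λ p → Σ (Fin r) λ q → (p , q) ∈ T × g ≡ newEdge (p , q))
    reduced-edge-cases {g} m with ∈-++⁻ (filterᵇ keep (State.edges s)) m
    ... | inj₁ m1 with ∈-filter⁻ (λ x → T? (keep x)) {xs = State.edges s} m1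
    ...   | m2 , k = inj₁ (m2 , avoids-if-survives (pathSrc G g N.≟ i) (pathTgt G g N.≟ i) k)
    reduced-edge-cases {g} m | inj₂ m1 with ∈-map⁻ newEdge m1
    ...   | (p , q) , pq , eq = inj₂ (p , q , pq , eq)

    survivor-∈ : ∀ {g} → g ∈ State.edges s → ¬ (pathSrc G g ≡ i) → ¬ (pathTgt G g ≡ i) → g ∈ State.edges s'
    survivor-∈ {g} m ns nt =
      ∈-++⁺ˡ (∈-filter⁺ (λ x → T? (keep x)) m (survives-if-avoids (pathSrc G g N.≟ i) (pathTgt G g N.≟ i) ns nt))

    newEdge-∈ : ∀ {p q} → (p , q) ∈ T → newEdge (p , q) ∈ State.edges s'
    newEdge-∈ pq = ∈-++⁺ʳ (filterᵇ keep (State.edges s)) (∈-map⁺ newEdge pq)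

    newEdge-snoc : ∀ p q → newEdge (p , q) ≡ lookup I p ++ [ outEdge q ]
    newEdge-snoc p q = cong (lookup I p ++_) (O-outEdge q)

    newEdge-path : ∀ p q → Path G 1 (newEdge (p , q)) (tgt (outEdge q))
    newEdge-path p q = subst (λ z → Path G 1 z _) (sym (newEdge-snoc p q)) (path-snoc (I-path p) (src-outEdge q))

    newEdge-interior : ∀ p q → Interior (suc i) (newEdge (p , q))
    newEdge-interior p q = subst (Interior (suc i)) (sym (newEdge-snoc p q)) (interior-snoc _ (I-interior p) (I-ends p))

    newEdge-tgt : ∀ q → suc i ≤ tgt (outEdge q)
    newEdge-tgt q = subst (_< tgt (outEdge q)) (src-outEdge q) (src<tgt (outEdge q))

    survivor-shape : ∀ h → h ∈ State.edges s → ¬ (pathTgt G h ≡ i) → (Σ (Fin m) λ e → h ≡ [ e ]) ⊎ AvoidsInside i h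
    survivor-shape h hm nt with edgeGood h hm
    ... | inj₁ (e , eq , _) = inj₁ (e , eq)
    ... | inj₂ (b , pth , le , it) = inj₂ avoids
      where
        avoids : AvoidsInside i h
        avoids ha [] eq en = nt (trans (path-tgt pth)
          (ends-unique (path-ends pth) (subst (λ z → EndsAt G z i) (sym (trans eq (++-identityʳ ha))) en)))
        avoids ha hb@(_ ∷ _) eq en = NP.<-irrefl refl (it ha hb i eq (λ ()) en)

    -- At i, two new edges I_p O_q and I_p' O_q' can only be incoherent if
    -- I_p < I_p' while O_q' < O_q; since both framings are sorted this means
    -- p < p' and q' < q, i.e. the tree edges cross.
    new-new-at-i : ∀ p q p' q' → (p , q) ∈ T → (p' , q') ∈ T → InLess G (lookup I p) (lookup I p') →
                   outEdge q' ≢ outEdge q → Precedes (outFr (src (outEdge q'))) (outEdge q') (outEdge q) → ⊥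
    new-new-at-i p q p' q' pq pq' il ne pr with NP.<-cmp (toℕ q) (toℕ q')
    ... | tri< lt _ _ with O-ordered lt
    ...   | c , c' , eq1 , eq2 , _ , pr2 with trans (sym eq1) (O-outEdge q) | trans (sym eq2) (O-outEdge q')
    ...     | refl | refl = precedes-asym (proj₁ (outFrOK i inner-i)) pr2
                              (subst (λ v → Precedes (outFr v) (outEdge q') (outEdge q)) (src-outEdge q') pr)
    new-new-at-i p q p' q' pq pq' il ne pr | tri≈ _ t _ with FP.toℕ-injective t
    ... | refl = ne refl
    new-new-at-i p q p' q' pq pq' il ne pr | tri> _ _ gt with NP.<-cmp (toℕ p) (toℕ p')
    ... | tri< lt' _ _ = proj₂ ncT p q p' q' pq pq' lt' gt
    ... | tri≈ _ t _ with FP.toℕ-injective t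
    ...   | refl = InLess-irrefl il
    new-new-at-i p q p' q' pq pq' il ne pr | tri> _ _ gt | tri> _ _ gt' =
      InLess-asym (I-bounded p) il (I-less gt')

    new-new-coherent : ∀ p q p' q' → (p , q) ∈ T → (p' , q') ∈ T → PartiallyCoherent (newEdge (p , q)) (newEdge (p' , q'))
    new-new-coherent p q p' q' pq pq' =
      subst₂ PartiallyCoherent (sym (newEdge-snoc p q)) (sym (newEdge-snoc p' q'))
        (coherent-extend-both (lookup I p) (outEdge q) (lookup I p') (outEdge q')
          (edgeCoh _ _ (I-edges p) (I-edges p')) (I-ends p) (I-ends p') (I-interior p) (I-interior p')
          (new-new-at-i p q p' q' pq pq'))

    reduced-coherent : ∀ g h → g ∈ State.edges s' → h ∈ State.edges s' → PartiallyCoherent g h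
    reduced-coherent g h gm hm with reduced-edge-cases gm | reduced-edge-cases hm
    ... | inj₁ (gm₀ , _ , _) | inj₁ (hm₀ , _ , _) = edgeCoh g h gm₀ hm₀
    ... | inj₂ (p , q , pq , refl) | inj₂ (p' , q' , pq' , refl) = new-new-coherent p q p' q' pq pq'
    ... | inj₂ (p , q , pq , refl) | inj₁ (hm₀ , _ , nt) with survivor-shape h hm₀ nt
    ...   | inj₁ (e₀ , refl) = single-coherentʳ _ e₀
    ...   | inj₂ avoids = subst (λ z → PartiallyCoherent z h) (sym (newEdge-snoc p q))
                            (coherent-extendˡ (lookup I p) (outEdge q) h (edgeCoh _ _ (I-edges p) hm₀) (I-ends p) avoids)
    reduced-coherent g h gm hm | inj₁ (gm₀ , _ , nt) | inj₂ (p , q , pq , refl) with survivor-shape g gm₀ nt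
    ...   | inj₁ (e₀ , refl) = single-coherentˡ e₀ _
    ...   | inj₂ avoids = subst (PartiallyCoherent g) (sym (newEdge-snoc p q))
                            (coherent-extendʳ (lookup I p) (outEdge q) g (edgeCoh _ _ gm₀ (I-edges p)) (I-ends p) avoids)

    reduced-inGood : ∀ j → i < j → j < n → ∀ {x} → x ∈ concatMap expandIn (State.inO s j) → GoodIn (suc i) j x
    reduced-inGood j a b {x} xm with ∈-concatMap-find expandIn xm
    ... | g , gm , xm' with ∈-expand g (pathSrc G g N.≟ i) xm' | All.lookup (inGood j (NP.<⇒≤ a) b) gm
    ... | inj₁ (ns , refl) | inj₁ (e , refl , t , le) = inj₁ (e , refl , t , NP.≤∧≢⇒< le (λ eq → ns (sym eq)))
    ... | inj₁ (ns , refl) | inj₂ pth = inj₂ pth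
    ... | inj₂ (se , p , q , refl , oq , pq) | inj₂ pth =
          ⊥-elim (NP.<-irrefl refl (NP.≤-trans 2≤i (NP.≤-reflexive (trans (sym se) (path-src pth)))))
    ... | inj₂ (se , p , q , refl , oq , pq) | inj₁ (e₀ , geq , t , le) =
          inj₂ (subst (Path G 1 (newEdge (p , q))) tq (newEdge-path p q))
      where tq : tgt (outEdge q) ≡ j
            tq = trans (cong tgt (∷-injectiveˡ (trans (sym (O-outEdge q)) (trans oq geq)))) t

    reduced-inAll : ∀ j → i < j → j < n → ∀ x → x ∈ State.edges s' → pathTgt G x ≡ j → x ∈ concatMap expandIn (State.inO s j)
    reduced-inAll j a b x xm t with reduced-edge-cases xm
    ... | inj₁ (xm₀ , ns , nt) = ∈-concatMap-at expandIn (inAll j (NP.<⇒≤ a) b x xm₀ t) (self-∈-expand x (pathSrc G x N.≟ i) ns)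
    ... | inj₂ (p , q , pq , refl) =
          ∈-concatMap-at expandIn eInj (newEdge-∈-expand [ outEdge q ] (pathSrc G [ outEdge q ] N.≟ i) p q (src-outEdge q) pq (O-outEdge q))
      where
        te : tgt (outEdge q) ≡ j
        te = trans (sym (pathTgt-snoc (lookup I p) (outEdge q))) (trans (cong (pathTgt G) (sym (newEdge-snoc p q))) t)
        eInj : [ outEdge q ] ∈ State.inO s j
        eInj = inAll j (NP.<⇒≤ a) b [ outEdge q ] (edgeKept (outEdge q) (NP.≤-reflexive (sym (src-outEdge q)))) te

    reduced-inEdges : ∀ j → i < j → j < n → ∀ x → x ∈ concatMap expandIn (State.inO s j) → x ∈ State.edges s'
    reduced-inEdges j a b x xm with ∈-concatMap-find expandIn xm
    ... | g , gm , xm' with ∈-expand g (pathSrc G g N.≟ i) xm'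
    ... | inj₁ (ns , refl) = survivor-∈ (inEdges j (NP.<⇒≤ a) b g gm) ns (λ eq → lt⇒≢ a (trans (sym tj) eq))
      where tj : pathTgt G g ≡ j
            tj with All.lookup (inGood j (NP.<⇒≤ a) b) gm
            ... | inj₁ (e , refl , t , _) = t
            ... | inj₂ pth = path-tgt pth
    ... | inj₂ (_ , p , q , refl , _ , pq) = newEdge-∈ pq

    reduced-edgeGood : ∀ g → g ∈ State.edges s' → GoodEdge (suc i) g
    reduced-edgeGood g gm with reduced-edge-cases gm
    ... | inj₁ (gm₀ , ns , nt) with edgeGood g gm₀
    ...   | inj₁ (e , refl , le) = inj₁ (e , refl , NP.≤∧≢⇒< le (λ eq → ns (sym eq)))
    ...   | inj₂ (b , pth , le , it) =
            inj₂ (b , pth , NP.≤∧≢⇒< le (λ eq → nt (trans (path-tgt pth) (sym eq))) , interior-suc it)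
    reduced-edgeGood g gm | inj₂ (p , q , pq , refl) =
      inj₂ (tgt (outEdge q) , newEdge-path p q , newEdge-tgt q , newEdge-interior p q)

    reduced-edgeKept : ∀ e → suc i ≤ src e → [ e ] ∈ State.edges s'
    reduced-edgeKept e le = survivor-∈ (edgeKept e (NP.<⇒≤ le)) (λ eq → lt⇒≢ le eq) (λ eq → lt⇒≢ (NP.<-trans le (src<tgt e)) eq)

    inv-reduced : Inv (suc i) s'
    inv-reduced = record
      { 2≤i = NP.m≤n⇒m≤1+n 2≤i
      ; outSingle = λ j a b → subst (All _) (sym (outO-reduced j a b)) (outSingle j (NP.<⇒≤ a) b)
      ; outSorted = λ j a b → subst (AllPairs (OutOrdered j)) (sym (outO-reduced j a b)) (outSorted j (NP.<⇒≤ a) b)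
      ; outAll = λ j a b e se → subst ([ e ] ∈_) (sym (outO-reduced j a b)) (outAll j (NP.<⇒≤ a) b e se)
      ; inGood = λ j a b → subst (All (GoodIn (suc i) j)) (sym (inO-reduced j (lt⇒≢ a))) (All.tabulate (reduced-inGood j a b))
      ; inSorted = λ j a b → subst (AllPairs (InLess G)) (sym (inO-reduced j (lt⇒≢ a))) (inO-sorted j (NP.<⇒≤ a) b)
      ; inAll = λ j a b x xm t → subst (x ∈_) (sym (inO-reduced j (lt⇒≢ a))) (reduced-inAll j a b x xm t)
      ; inEdges = λ j a b x xm → reduced-inEdges j a b x (subst (x ∈_) (inO-reduced j (lt⇒≢ a)) xm)
      ; edgeGood = reduced-edgeGood
      ; edgeKept = reduced-edgeKept
      ; edgeCoh = reduced-coherent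
      }

    -- One step of following a route.  Every edge from 1 grows into an edge of
    -- the reduced graph (its end i, if reached, is covered by a tree edge).
    src≡1⇒≢i : ∀ {g} → pathSrc G g ≡ 1 → ¬ (pathSrc G g ≡ i)
    src≡1⇒≢i sg eq = NP.<-irrefl refl (NP.≤-trans 2≤i (NP.≤-reflexive (trans (sym eq) sg)))

    extend-one-step : ∀ g → g ∈ State.edges s → pathSrc G g ≡ 1 → ∃ λ t → g ++ t ∈ State.edges s'
    extend-one-step g gm sg with pathTgt G g N.≟ i
    ... | no nt = [] , subst (_∈ State.edges s') (sym (++-identityʳ g)) (survivor-∈ gm (src≡1⇒≢i {g} sg) nt)
    ... | yes t with index-of (inAll i i≤i i<n g gm t) | proj₂ (hasInOut i inner-i)
    ...   | p , lp | e₀ , se₀ with index-of (outAll i i≤i i<n e₀ se₀)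
    ...     | q₀ , _ with left-vertex-covered T ncT p q₀
    ...       | q , pq = lookup O q , subst (_∈ State.edges s') (cong (_++ lookup O q) lp) (newEdge-∈ pq)

    crossing-incoherent : ∀ {R} p q k p' q' t → R ≡ lookup I p ++ (lookup O q ++ k) →
                          Coherent G R (newEdge (p' , q') ++ t) → Crosses p q p' q' → ⊥
    crossing-incoherent p q k p' q' t eR coh c
      with coh i inner-i (lookup I p) (lookup O q ++ k) (lookup I p') (lookup O q' ++ t)
               eR (++-assoc (lookup I p') (lookup O q') t) (I-ends p) (I-ends p')
    ... | atP , atQ with c
    ...   | inj₁ (p'<p , q<q') = atQ (I-less p'<p , O-less q<q' k t)
    ...   | inj₂ (p<p' , q'<q) = atP (I-less p<p' , O-less q'<q t k)

    -- If a route R is coherent with (extensions of) all new edges, then a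
    -- nonempty prefix of R that is an edge grows into an edge of the reduced
    -- graph: at i its continuation I_p O_q must be a tree edge, since
    -- otherwise a crossing tree edge would make R incoherent.
    advance-prefix : ∀ {R} g k → Route G R → R ≡ g ++ k → g ≢ [] → g ∈ State.edges s →
      (∀ p q → (p , q) ∈ T → ∃ λ t → Coherent G R (newEdge (p , q) ++ t)) →
      ∃ λ g' → ∃ λ k' → R ≡ g' ++ k' × g' ≢ [] × g' ∈ State.edges s'
    advance-prefix {R} g k route eR ne gm cohNew with pathTgt G g N.≟ i
    ... | no nt = g , k , eR , ne , survivor-∈ gm (src≡1⇒≢i {g} sg) nt
      where sg : pathSrc G g ≡ 1
            sg = trans (sym (pathSrc-++ g k ne)) (trans (cong (pathSrc G) (sym eR)) (path-src route))
    ... | yes t with k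
    ...   | [] = ⊥-elim (NP.<-irrefl (trans (sym t) (trans (cong (pathTgt G) (trans (sym (++-identityʳ g)) (sym eR)))
                                                              (path-tgt route))) i<n)
    ...   | e ∷ k' with index-of (inAll i i≤i i<n g gm t)
                   | index-of (outAll i i≤i i<n e (trans (path-junction g ne (subst (λ z → Path G 1 z n) eR route)) t))
    ...     | p , lp | q , lq with treeEdge? p q
    ...       | yes pq = g ++ [ e ] , k' , trans eR (sym (++-assoc g [ e ] k')) , (λ eq → ne (++-conicalˡ g _ eq)) ,
                         subst (_∈ State.edges s') (cong₂ _++_ lp lq) (newEdge-∈ (Any.map sym pq))
    ...       | no npq = ⊥-elim (missing-edge-is-crossed T ncT p q (λ m → npq (Any.map sym m)) crossed)
      where
        eR' : R ≡ lookup I p ++ (lookup O q ++ k')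
        eR' = trans eR (cong₂ (λ a b → a ++ (b ++ k')) (sym lp) (sym lq))
        crossed : ∀ p' q' → (p' , q') ∈ T → Crosses p q p' q' → ⊥
        crossed p' q' pq' with cohNew p' q' pq'
        ... | t' , coh = crossing-incoherent p q k' p' q' t' eR' coh

  inv-final : ∀ {i s sf} → Inv i s → Runs G i s sf → Σ ℕ λ k → Inv k sf × n ≤ k
  inv-final inv (finish le) = _ , inv , le
  inv-final {i} {s} inv (step lt T ncT rs) = inv-final (Step.inv-reduced s i T inv lt ncT) rs

  final-route : ∀ {k s} → Inv k s → n ≤ k → ∀ g → g ∈ State.edges s → Route G g
  final-route inv le g gm with Inv.edgeGood inv g gm
  ... | inj₁ (e , refl , le') =
        ⊥-elim (NP.<-irrefl refl (NP.<-≤-trans (src<tgt e) (NP.≤-trans (tgt≤n e) (NP.≤-trans le le'))))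
  ... | inj₂ (b , pth , le' , _) = subst (Path G 1 g) (NP.≤-antisym (path-le-n pth) (NP.≤-trans le le')) pth

  extend-to-final : ∀ {i s sf} → Inv i s → Runs G i s sf → ∀ g → g ∈ State.edges s → pathSrc G g ≡ 1 →
                    ∃ λ t → g ++ t ∈ State.edges sf
  extend-to-final inv (finish le) g gm sg = [] , subst (_∈ _) (sym (++-identityʳ g)) gm
  extend-to-final {i} {s} inv (step lt T ncT rs) g gm sg with Step.extend-one-step s i T inv lt ncT g gm sg
  ... | t , m with extend-to-final (Step.inv-reduced s i T inv lt ncT) rs (g ++ t) m
                     (trans (pathSrc-++ g t (src≡1⇒nonempty g sg)) sg)
  ...   | t' , m' = t ++ t' , subst (_∈ _) (++-assoc g t t') m'

  prefix-survives : ∀ {i s sf} → Inv i s → Runs G i s sf → ∀ R → Route G R → (∀ P → P ∈ State.edges sf → Coherent G R P) →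
                    ∀ g k → R ≡ g ++ k → g ≢ [] → g ∈ State.edges s → R ∈ State.edges sf
  prefix-survives inv (finish le) R route coh g k eR ne gm
    with route-maximal route eR ne (final-route inv le g gm)
  ... | refl = subst (_∈ _) (sym (trans eR (++-identityʳ g))) gm
  prefix-survives {i} {s} inv (step lt T ncT rs) R route coh g k eR ne gm =
    let g' , k' , eR' , ne' , gm' = S.advance-prefix g k route eR ne gm coherent-with-new
    in prefix-survives S.inv-reduced rs R route coh g' k' eR' ne' gm'
    where
      module S = Step s i T inv lt ncT
      coherent-with-new : ∀ p q → (p , q) ∈ T → ∃ λ t → Coherent G R (S.newEdge (p , q) ++ t)
      coherent-with-new p q pq =
        let t , m = extend-to-final S.inv-reduced rs _ (S.newEdge-∈ pq) (path-src (S.newEdge-path p q))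
        in t , coh _ m

proposition6p3 : ∀ {n : ℕ} (G : FramedGraph n) → IsFramedGraph G →
    ∀ (s : State G) → Runs G 2 (initState G) s → MaximalClique G (State.edges s)
proposition6p3 G FG s rs with Reductions.inv-final G FG (Reductions.inv-init G FG) rs
... | k , invk , n≤k = (All.tabulate (λ {g} → final-route invk n≤k g) , coherent) , maximal
  where
    open Reductions G FG
    coherent : ∀ P Q → P ∈ State.edges s → Q ∈ State.edges s → Coherent G P Q
    coherent P Q pm qm = coherent-from-partial (Inv.edgeCoh invk P Q pm qm) (Inv.edgeCoh invk Q P qm pm)
    maximal : ∀ R → Route G R → (∀ P → P ∈ State.edges s → Coherent G R P) → R ∈ State.edges s
    maximal [] () coh
    maximal (e ∷ R) route coh =
      prefix-survives inv-init rs (e ∷ R) route coh [ e ] R refl (λ ()) (∈-map⁺ [_] (∈-allFin e))
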